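{- Let $P$ be an arbitrary protocol, $\mathcal R^{\mathsf{as}}=\mathcal R(P,\gamma^{\mathsf{as}})$, $r\in\mathcal R^{\mathsf{as}}$, and assume $e$ is an ND event occurring at $(i_0,t)$ in $r$. If $(\mathcal R^{\mathsf{as}},r,t')\vDash K_{i_k}K_{i_{k-1}}\cdots K_{i_1}\,\mathrm{ndocc}(e)$, then there is a chain $(i_0,t)\twoheadrightarrow(i_1,t_1)\twoheadrightarrow\cdots\twoheadrightarrow(i_k,t_k)$ in $(r,t..t')$.
   Context: Model $\gamma^{\mathsf{as}}$ (Asynch-delivery): a finite set of processes communicates over a directed network; time is global and discrete and every local state contains the current time; every channel has bound $b_{ij}=\infty$, i.e. a message sent at time $s$ is received at some nondeterministically chosen finite time $>s$; processes may receive nondeterministic external inputs. $\mathcal R(P,\gamma^{\mathsf{as}})$ is the set of all runs of $P$ in this context. A node $(i,t)$ is process $i$ at time $t$; $r_i(t)$ is $i$'s local state. ND events: external inputs and early receives (receipts before the bound, here any receipt). Knowledge: $(\mathcal R,r,t)\vDash K_i\varphi$ iff $(\mathcal R,r',t)\vDash\varphi$ for all $r'\in\mathcal R$ with $r'_i(t)=r_i(t)$. $(\mathcal R,r,t)\vDash\mathrm{ndocc}(e)$ iff $e$ occurred in $r$ at some time $\le t$ as an ND event. Happened-before $\twoheadrightarrow$ on nodes of $r$ (Lamport): the smallest transitive relation with $(i,s)\twoheadrightarrow(i,s')$ for $s\le s'$ and $(i,s)\twoheadrightarrow(j,s')$ whenever a message sent at $(i,s)$ is received at $(j,s')$. A chain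 "in $(r,t..t')$" consists of nodes with times in $[t,t']$. -}

module Defs where

open import Data.Nat using (ℕ; zero; suc; _≤_; _<_)
import Data.Nat as ℕ
open import Data.Fin using (Fin)
import Data.Fin as Fin
open import Data.List using (List; []; _∷_; [_]; length; lookup; concatMap; upTo; allFin)
open import Data.Maybe using (Maybe; just)
open import Data.Bool using (if_then_else_; _∧_)
open import Data.Product using (Σ; ∃; _×_; _,_; proj₁; proj₂)
open import Relation.Nullary.Decidable using (⌊_⌋)
open import Relation.Binary.PropositionalEquality using (_≡_)

-- The context γ^as (asynchronous delivery, every channel bound = ∞).  A process's local state at time t is the
-- pair (t , σ) with σ : L, so every local state contains the current time.
-- Init is the set of admissible initial (global) states, and δ is the local
-- state-update function: the state at time t is obtained from the state at
-- time t-1 (resp. the initial state) and the events observed at time t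
-- (the external input, if any, and the list of (sender , message) received).
record Context : Set₁ where
  field
    n    : ℕ
    Net  : Fin n → Fin n → Set
    Msg  : Set
    Inp  : Set
    L    : Set
    Init : (Fin n → L) → Set
    δ    : Fin n → ℕ → L → Maybe Inp × List (Fin n × Msg) → L

Protocol : Context → Set
Protocol C = (i : Fin n) → ℕ × L → List (Σ (Fin n) λ j → Net i j × Msg)
  where open Context C

module Runs (C : Context) (P : Protocol C) where
  open Context C public

  Node : Set
  Node = Fin n × ℕ

  sends : (Fin n → ℕ → L) → (i : Fin n) → ℕ → List (Σ (Fin n) λ j → Net i j × Msg)
  sends st i s = P i (s , st i s)

  DeliverFn : (Fin n → ℕ → L) → Set
  DeliverFn st = (i : Fin n) (s : ℕ) → Fin (length (sends st i s)) → ℕ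

  recvd : (st : Fin n → ℕ → L) → DeliverFn st → Fin n → ℕ → List (Fin n × Msg)
  recvd st dl j t =
    concatMap (λ s → concatMap (λ i → fromAt i s) (allFin n)) (upTo t)
    where
    fromAt : Fin n → ℕ → List (Fin n × Msg)
    fromAt i s = concatMap
      (λ k → if ⌊ proj₁ (lookup (sends st i s) k) Fin.≟ j ⌋ ∧ ⌊ dl i s k ℕ.≟ t ⌋
             then [ (i , proj₂ (proj₂ (lookup (sends st i s) k))) ] else [])
      (allFin (length (sends st i s)))

  -- A run of P in γ^as.  R(P, γ^as) is the type of all such runs.
  record Run : Set where
    field
      init     : Fin n → L
      init-ok  : Init init
      inp      : Fin n → ℕ → Maybe Inp
      st       : Fin n → ℕ → L
      dl       : DeliverFn st
      dl-later : ∀ i s k → s < dl i s k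
      st-0     : ∀ i → st i 0 ≡ δ i 0 (init i) (inp i 0 , recvd st dl i 0)
      st-suc   : ∀ i t → st i (suc t) ≡ δ i (suc t) (st i t) (inp i (suc t) , recvd st dl i (suc t))

  open Run public

  local : Run → Fin n → ℕ → ℕ × L
  local r i t = (t , st r i t)

  Delivered : Run → Node → Node → Set
  Delivered r (i , s) (j , s') =
    Σ (Fin (length (sends (st r) i s))) λ k →
      (proj₁ (lookup (sends (st r) i s) k) ≡ j) × (dl r i s k ≡ s')

  data HB (r : Run) : Node → Node → Set where
    hb-local : ∀ {i s s'} → s ≤ s' → HB r (i , s) (i , s')
    hb-msg   : ∀ {a b} → Delivered r a b → HB r a b
    hb-trans : ∀ {a b c} → HB r a b → HB r b c → HB r a c

  -- ND events: external inputs and (early) receives; here every receive is early.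
  data NDEvent : Set where
    ext : (i : Fin n) (t : ℕ) (v : Inp) → NDEvent
    rcv : (j : Fin n) (t : ℕ) (i : Fin n) (μ : Msg) → NDEvent

  evProc : NDEvent → Fin n
  evProc (ext i _ _)   = i
  evProc (rcv j _ _ _) = j

  evTime : NDEvent → ℕ
  evTime (ext _ t _)   = t
  evTime (rcv _ t _ _) = t

  Occurs : Run → NDEvent → Set
  Occurs r (ext i t v)   = inp r i t ≡ just v
  Occurs r (rcv j t i μ) = ∃ λ s → Σ (Fin (length (sends (st r) i s))) λ k →
    (proj₁ (lookup (sends (st r) i s) k) ≡ j) × (dl r i s k ≡ t)
      × (proj₂ (proj₂ (lookup (sends (st r) i s) k)) ≡ μ)

  Formula : Set₁
  Formula = Run → ℕ → Set

  ndocc : NDEvent → Formula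
  ndocc e r t = Occurs r e × evTime e ≤ t

  K : Fin n → Formula → Formula
  K i φ r t = ∀ (r' : Run) → local r' i t ≡ local r i t → φ r' t

  -- Knest (i₁ ∷ … ∷ iₖ ∷ []) φ  =  K_{iₖ} … K_{i₁} φ
  Knest : List (Fin n) → Formula → Formula
  Knest []       φ = φ
  Knest (i ∷ is) φ = Knest is (K i φ)

  -- Chain r lo hi i s (i₁ ∷ … ∷ iₖ ∷ []) : there are times t₁ … tₖ with
  -- (i , s) ↠ (i₁ , t₁) ↠ … ↠ (iₖ , tₖ), all nodes having times in [lo , hi].
  data Chain (r : Run) (lo hi : ℕ) : Fin n → ℕ → List (Fin n) → Set where
    done : ∀ {i s} → lo ≤ s → s ≤ hi → Chain r lo hi i s []
    step : ∀ {i s j s' js} → lo ≤ s → s ≤ hi → HB r (i , s) (j , s')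
         → Chain r lo hi j s' js → Chain r lo hi i s (j ∷ js)

module Submission where

-- The proof is by induction on the list of knowers, taken from the
-- right.  For the last knower k at time H = t' we build a "cut" run r' that
-- process k cannot tell apart from r at H: on the causal past D of (k , H) in r
-- (a decidable, time-downward-closed set of nodes, closed under senders) r' copies
-- r exactly; outside D there are no external inputs and every message that does
-- not stay inside D is postponed beyond H.  The states outside D are determined
-- by the protocol; they are obtained as the fixpoint of a causal recursion on
-- time (CausalFixpoint).  Since k knows K_{i_{k-1}} ... ndocc(e), the inner
-- formula holds at r', which by induction yields a chain in r'; e occurs in r',
-- hence its node lies in D.  In r' nothing leaves a node outside D by time H
-- except its own timeline, so every chain of r' starting in D can be pulled
-- back to a chain of r whose nodes stay in D (transfer), and the last node then
-- happens before (k , H).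

open import Defs
open import Data.Nat using (ℕ; zero; suc; _≤_; _<_; _+_; _∸_; s≤s; _≤?_; _≤′_; ≤′-refl; ≤′-step)
import Data.Nat as ℕ
open import Data.Nat.Properties
  using (≤-refl; ≤-trans; <⇒≤; <-≤-trans; ≤-pred; n≤1+n; n<1+n; n≮0; m≤m+n; m≤n+m; m∸n≤m; ∸-monoʳ-<; <-irrefl; ≤⇒≤′; m≤n⇒m<n∨m≡n)
open import Data.Fin using (Fin)
import Data.Fin as Fin
open import Data.Fin.Properties using (any?)
open import Data.List using (List; []; _∷_; [_]; _∷ʳ_; length; lookup; concat; concatMap; upTo; allFin)
open import Data.List.Properties using (concatMap-cong; map-cong-local)
open import Data.List.Membership.Propositional.Properties using (∈-upTo⁻)
import Data.List.Relation.Unary.All as All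
open import Data.List.Reverse using (Reverse; []; _∶_∶ʳ_; reverseView)
open import Data.Maybe using (Maybe; nothing)
open import Data.Bool using (if_then_else_; _∧_)
open import Data.Product using (Σ; ∃; _×_; _,_; proj₁; proj₂)
open import Data.Sum using (_⊎_; inj₁; inj₂)
open import Data.Empty using (⊥; ⊥-elim)
open import Function using (case_of_)
open import Relation.Nullary using (Dec; yes; no; ¬_)
open import Relation.Nullary.Decidable using (⌊_⌋; map′; _⊎-dec_; _×-dec_)
open import Relation.Binary.PropositionalEquality using (_≡_; _≢_; refl; sym; trans; cong; cong₂)
open Relation.Binary.PropositionalEquality.≡-Reasoning

concatMap-cong-upTo : ∀ {B : Set} {f g : ℕ → List B} u →
  (∀ s → s < u → f s ≡ g s) → concatMap f (upTo u) ≡ concatMap g (upTo u)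
concatMap-cong-upTo u agree =
  cong concat (map-cong-local (All.tabulate (λ s∈ → agree _ (∈-upTo⁻ s∈))))

concatMap-[] : ∀ {A B : Set} (f : A → List B) xs → (∀ x → f x ≡ []) → concatMap f xs ≡ []
concatMap-[] f []       empty = refl
concatMap-[] f (x ∷ xs) empty rewrite empty x = concatMap-[] f xs empty

keep : ∀ {A B : Set} → Dec A → B → B → B
keep (yes _) x y = x
keep (no _)  x y = y

keep-yes : ∀ {A B : Set} (d : Dec A) {x y : B} → A → keep d x y ≡ x
keep-yes (yes _) a = refl
keep-yes (no ¬a) a = ⊥-elim (¬a a)

keep-no : ∀ {A B : Set} (d : Dec A) {x y : B} → ¬ A → keep d x y ≡ y
keep-no (yes a) ¬a = ⊥-elim (¬a a)
keep-no (no _)  ¬a = refl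

-- Recursion on time: if F h i u depends on h only at times below u, then F has
-- a fixpoint.  It is the diagonal of the iterates F^m(const a), since the
-- m-th iterate is already correct at all times below m.
module CausalFixpoint {I A : Set} (a : A) (F : (I → ℕ → A) → I → ℕ → A)
  (causal : ∀ h h' i u → (∀ j s → s < u → h j s ≡ h' j s) → F h i u ≡ F h' i u) where

  approx : ℕ → I → ℕ → A
  approx zero    _ _ = a
  approx (suc m)     = F (approx m)

  approx-step : ∀ m i s → s < m → approx (suc m) i s ≡ approx m i s
  approx-step (suc m) i s s<m =
    causal (approx (suc m)) (approx m) i s
      (λ j s' s'<s → approx-step m j s' (<-≤-trans s'<s (≤-pred s<m)))

  fix : I → ℕ → A
  fix i s = approx (suc s) i s

  approx-stable : ∀ m i s → s < m → approx m i s ≡ fix i s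
  approx-stable (suc m) i s s<m with m≤n⇒m<n∨m≡n (≤-pred s<m)
  ... | inj₁ s<m' = trans (approx-step m i s s<m') (approx-stable m i s s<m')
  ... | inj₂ refl = refl

  fix-eq : ∀ i u → fix i u ≡ F fix i u
  fix-eq i u = causal (approx u) fix i u (approx-stable u)

module Semantics (C : Context) (P : Protocol C) where
  open Runs C P

  -- Happened-before never goes back in time (deliveries are strictly later).
  HB-mono : ∀ {r x y} → HB r x y → proj₂ x ≤ proj₂ y
  HB-mono (hb-local le) = le
  HB-mono {r} (hb-msg {i , s} (q , _ , refl)) = <⇒≤ (dl-later r i s q)
  HB-mono (hb-trans a b) = ≤-trans (HB-mono a) (HB-mono b)

  chain-≤hi : ∀ {r lo hi i s js} → Chain r lo hi i s js → s ≤ hi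
  chain-≤hi (done _ le)     = le
  chain-≤hi (step _ le _ _) = le

  prevState : Run → Fin n → ℕ → L
  prevState r j zero    = init r j
  prevState r j (suc u) = st r j u

  run-update : ∀ r j u → st r j u ≡ δ j u (prevState r j u) (inp r j u , recvd (st r) (dl r) j u)
  run-update r j zero    = st-0 r j
  run-update r j (suc u) = st-suc r j u

  -- The messages of the send list sd of process i, delivered by del, that j
  -- receives at time u; recvd is the concatenation of these over all senders.
  inbox : (i : Fin n) (sd : List (Σ (Fin n) λ j → Net i j × Msg)) →
    (Fin (length sd) → ℕ) → Fin n → ℕ → List (Fin n × Msg)
  inbox i sd del j u = concatMap
    (λ q → if ⌊ proj₁ (lookup sd q) Fin.≟ j ⌋ ∧ ⌊ del q ℕ.≟ u ⌋
           then [ (i , proj₂ (proj₂ (lookup sd q))) ] else [])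
    (allFin (length sd))

  inbox-none : ∀ i sd del j u → (∀ q → proj₁ (lookup sd q) ≡ j → del q ≢ u) →
    inbox i sd del j u ≡ []
  inbox-none i sd del j u never = concatMap-[] _ (allFin (length sd)) item
    where
    item : ∀ q → (if ⌊ proj₁ (lookup sd q) Fin.≟ j ⌋ ∧ ⌊ del q ℕ.≟ u ⌋
                  then [ (i , proj₂ (proj₂ (lookup sd q))) ] else []) ≡ []
    item q with proj₁ (lookup sd q) Fin.≟ j
    ... | no _ = refl
    ... | yes to-j with del q ℕ.≟ u
    ...   | no _     = refl
    ...   | yes at-u = ⊥-elim (never q to-j at-u)

  inbox-agree : ∀ i sd del del' j u →
    (∀ q → proj₁ (lookup sd q) ≡ j → del q ≡ u → del' q ≡ u) →
    (∀ q → proj₁ (lookup sd q) ≡ j → del' q ≡ u → del q ≡ u) →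
    inbox i sd del j u ≡ inbox i sd del' j u
  inbox-agree i sd del del' j u there back = concatMap-cong item (allFin (length sd))
    where
    item : ∀ q → (if ⌊ proj₁ (lookup sd q) Fin.≟ j ⌋ ∧ ⌊ del q ℕ.≟ u ⌋
                  then [ (i , proj₂ (proj₂ (lookup sd q))) ] else [])
               ≡ (if ⌊ proj₁ (lookup sd q) Fin.≟ j ⌋ ∧ ⌊ del' q ℕ.≟ u ⌋
                  then [ (i , proj₂ (proj₂ (lookup sd q))) ] else [])
    item q with proj₁ (lookup sd q) Fin.≟ j
    ... | no _ = refl
    ... | yes to-j with del q ℕ.≟ u | del' q ℕ.≟ u
    ...   | yes _   | yes _    = refl
    ...   | no _    | no _     = refl
    ...   | yes at  | no ¬at'  = ⊥-elim (¬at' (there q to-j at))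
    ...   | no ¬at  | yes at'  = ⊥-elim (¬at (back q to-j at'))

  Knest-∷ʳ : ∀ js k φ r t → Knest (js ∷ʳ k) φ r t → K k (Knest js φ) r t
  Knest-∷ʳ []       k φ r t kn = kn
  Knest-∷ʳ (j ∷ js) k φ r t kn = Knest-∷ʳ js k (K j φ) r t kn

  Knest-veridical : ∀ is φ r t → Knest is φ r t → φ r t
  Knest-veridical []       φ r t holds = holds
  Knest-veridical (i ∷ is) φ r t kn    = Knest-veridical is (K i φ) r t kn r refl

  module Cut (r : Run) (k : Fin n) (H : ℕ) where

    data Past : Fin n → ℕ → Set where
      here    : Past k H
      earlier : ∀ {j s} → Past j (suc s) → Past j s
      sender  : ∀ {i s j s'} → Delivered r (i , s) (j , s') → Past j s' → Past i s

    Past⇒HB : ∀ {j s} → Past j s → HB r (j , s) (k , H)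
    Past⇒HB here         = hb-local ≤-refl
    Past⇒HB (earlier p)  = hb-trans (hb-local (n≤1+n _)) (Past⇒HB p)
    Past⇒HB (sender d p) = hb-trans (hb-msg d) (Past⇒HB p)

    Past-≤H : ∀ {j s} → Past j s → s ≤ H
    Past-≤H p = HB-mono (Past⇒HB p)

    Past-earlier : ∀ {j s s'} → s ≤ s' → Past j s' → Past j s
    Past-earlier s≤s' = go (≤⇒≤′ s≤s')
      where
      go : ∀ {j s s'} → s ≤′ s' → Past j s' → Past j s
      go ≤′-refl      p = p
      go (≤′-step le) p = go le (earlier p)

    -- One unfolding of Past; it makes membership decidable by recursion on H ∸ s.
    PastStep : Fin n → ℕ → Set
    PastStep j s = (j ≡ k × s ≡ H) ⊎ Past j (suc s)
      ⊎ ∃ λ q → Past (proj₁ (lookup (sends (st r) j s) q)) (dl r j s q)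

    Past-fold : ∀ {j s} → PastStep j s → Past j s
    Past-fold (inj₁ (refl , refl))  = here
    Past-fold (inj₂ (inj₁ p))       = earlier p
    Past-fold (inj₂ (inj₂ (q , p))) = sender (q , refl , refl) p

    Past-unfold : ∀ {j s} → Past j s → PastStep j s
    Past-unfold here                         = inj₁ (refl , refl)
    Past-unfold (earlier p)                  = inj₂ (inj₁ p)
    Past-unfold (sender (q , refl , refl) p) = inj₂ (inj₂ (q , p))

    past?-fuel : ∀ f j s → (s ≤ H → H ∸ s < f) → Dec (Past j s)
    past?-fuel f j s bound with s ≤? H
    ... | no s≰H = no (λ p → s≰H (Past-≤H p))
    past?-fuel zero    j s bound | yes s≤H = ⊥-elim (n≮0 (bound s≤H))
    past?-fuel (suc f) j s bound | yes s≤H = map′ Past-fold Past-unfold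
      ((j Fin.≟ k ×-dec s ℕ.≟ H)
       ⊎-dec past?-fuel f j (suc s) (shrink (n<1+n s))
       ⊎-dec any? (λ q → past?-fuel f _ _ (shrink (dl-later r j s q))))
      where
      shrink : ∀ {s'} → s < s' → s' ≤ H → H ∸ s' < f
      shrink s<s' s'≤H = <-≤-trans (∸-monoʳ-< s<s' s'≤H) (≤-pred (bound s≤H))

    past? : ∀ j s → Dec (Past j s)
    past? j s = past?-fuel (suc H) j s (λ _ → s≤s (m∸n≤m H s))

    -- Postponed messages are delivered at late s, after H and after sending.
    late : ℕ → ℕ
    late s = suc (H + s)

    late-beyond : ∀ s {u} → late s ≡ u → u ≤ H → ⊥
    late-beyond s refl le = <-irrefl refl (≤-trans (s≤s (m≤m+n H s)) le)

    -- The cut run: inputs, states and deliveries are those of r inside the past;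
    -- outside it there are no inputs and the state σ is still to be chosen.
    inp' : Fin n → ℕ → Maybe Inp
    inp' i s = keep (past? i s) (inp r i s) nothing

    deliver : ∀ i s (d : Dec (Past i s)) (σ : L) → Fin (length (P i (s , keep d (st r i s) σ))) → ℕ
    deliver i s (yes _) σ q = keep (past? (proj₁ (lookup (sends (st r) i s) q)) (dl r i s q)) (dl r i s q) (late s)
    deliver i s (no _)  σ q = late s

    deliver-later : ∀ i s d σ q → s < deliver i s d σ q
    deliver-later i s (no _)  σ q = s≤s (m≤n+m s H)
    deliver-later i s (yes _) σ q with past? (proj₁ (lookup (sends (st r) i s) q)) (dl r i s q)
    ... | yes _ = dl-later r i s q
    ... | no _  = s≤s (m≤n+m s H)

    stOf : (Fin n → ℕ → L) → Fin n → ℕ → L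
    stOf h i s = keep (past? i s) (st r i s) (h i s)

    dlOf : (h : Fin n → ℕ → L) → DeliverFn (stOf h)
    dlOf h i s = deliver i s (past? i s) (h i s)

    prevOf : (Fin n → ℕ → L) → Fin n → ℕ → L
    prevOf h j zero    = init r j
    prevOf h j (suc u) = stOf h j u

    -- The protocol's update rule for the cut run; its fixpoint gives the states outside the past.
    update : (Fin n → ℕ → L) → Fin n → ℕ → L
    update h j u = δ j u (prevOf h j u) (inp' j u , recvd (stOf h) (dlOf h) j u)

    update-causal : ∀ h h' j u → (∀ i s → s < u → h i s ≡ h' i s) → update h j u ≡ update h' j u
    update-causal h h' j u agree =
      cong₂ (λ σ m → δ j u σ (inp' j u , m)) (prev-agree u agree)
        (concatMap-cong-upTo u (λ s s<u → concatMap-cong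
          (λ i → cong (λ σ → inbox i (P i (s , keep (past? i s) (st r i s) σ)) (deliver i s (past? i s) σ) j u)
                      (agree i s s<u))
          (allFin n)))
      where
      prev-agree : ∀ u → (∀ i s → s < u → h i s ≡ h' i s) → prevOf h j u ≡ prevOf h' j u
      prev-agree zero    _     = refl
      prev-agree (suc u) agree = cong (keep (past? j u) (st r j u)) (agree j u ≤-refl)

    open CausalFixpoint (init r k) update update-causal using (fix; fix-eq)

    st' : Fin n → ℕ → L
    st' = stOf fix

    dl' : DeliverFn st'
    dl' = dlOf fix

    st'-past : ∀ {j s} → Past j s → st' j s ≡ st r j s
    st'-past {j} {s} p = keep-yes (past? j s) p

    prev-past : ∀ {j u} → Past j u → prevOf fix j u ≡ prevState r j u
    prev-past {u = zero}  p = refl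
    prev-past {u = suc u} p = st'-past (earlier p)

    -- A node in the past receives in the cut run exactly what it receives in r:
    -- messages from outside the past cannot reach it in r and are postponed in r'.
    inbox-cut : ∀ {j u} → Past j u → ∀ i s (d : Dec (Past i s)) σ →
      inbox i (P i (s , keep d (st r i s) σ)) (deliver i s d σ) j u ≡ inbox i (sends (st r) i s) (dl r i s) j u
    inbox-cut {j} {u} pj i s (yes pi) σ = inbox-agree i (sends (st r) i s) (deliver i s (yes pi) σ) (dl r i s) j u there back
      where
      there : ∀ q → proj₁ (lookup (sends (st r) i s) q) ≡ j → deliver i s (yes pi) σ q ≡ u → dl r i s q ≡ u
      there q to-j at with past? (proj₁ (lookup (sends (st r) i s) q)) (dl r i s q)
      ... | yes _ = at
      ... | no _  = ⊥-elim (late-beyond s at (Past-≤H pj))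
      back : ∀ q → proj₁ (lookup (sends (st r) i s) q) ≡ j → dl r i s q ≡ u → deliver i s (yes pi) σ q ≡ u
      back q refl refl = keep-yes (past? _ _) pj
    inbox-cut {j} {u} pj i s (no ¬pi) σ =
      trans (inbox-none i (P i (s , σ)) (deliver i s (no ¬pi) σ) j u (λ q _ at → late-beyond s at (Past-≤H pj)))
            (sym (inbox-none i (sends (st r) i s) (dl r i s) j u (λ q to-j at → ¬pi (sender (q , to-j , at) pj))))

    recvd-cut : ∀ {j u} → Past j u → recvd st' dl' j u ≡ recvd (st r) (dl r) j u
    recvd-cut {j} {u} pj = concatMap-cong
      (λ s → concatMap-cong (λ i → inbox-cut pj i s (past? i s) (fix i s)) (allFin n)) (upTo u)

    state-cut : ∀ j u → st' j u ≡ δ j u (prevOf fix j u) (inp' j u , recvd st' dl' j u)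
    state-cut j u = case past? j u of λ
      { (yes p) → begin
          st' j u
            ≡⟨ st'-past p ⟩
          st r j u
            ≡⟨ run-update r j u ⟩
          δ j u (prevState r j u) (inp r j u , recvd (st r) (dl r) j u)
            ≡⟨ sym (cong₂ (δ j u) (prev-past p) (cong₂ _,_ (keep-yes (past? j u) p) (recvd-cut p))) ⟩
          δ j u (prevOf fix j u) (inp' j u , recvd st' dl' j u)
            ∎
      ; (no ¬p) → trans (keep-no (past? j u) ¬p) (fix-eq j u) }

    cutRun : Run
    cutRun = record
      { init     = init r
      ; init-ok  = init-ok r
      ; inp      = inp'
      ; st       = st'
      ; dl       = dl'
      ; dl-later = λ i s q → deliver-later i s (past? i s) (fix i s) q
      ; st-0     = λ j → state-cut j 0
      ; st-suc   = λ j u → state-cut j (suc u)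
      }

    local-cut : local cutRun k H ≡ local r k H
    local-cut = cong (H ,_) (st'-past here)

    deliver-cut : ∀ i s (d : Dec (Past i s)) σ (q : Fin (length (P i (s , keep d (st r i s) σ)))) {j s'} →
      proj₁ (lookup (P i (s , keep d (st r i s) σ)) q) ≡ j → deliver i s d σ q ≡ s' → s' ≤ H →
      Past i s × Past j s' × Delivered r (i , s) (j , s')
    deliver-cut i s (no _) σ q to-j at le = ⊥-elim (late-beyond s at le)
    deliver-cut i s (yes pi) σ q refl at le with past? (proj₁ (lookup (sends (st r) i s) q)) (dl r i s q)
    ... | no _ = ⊥-elim (late-beyond s at le)
    deliver-cut i s (yes pi) σ q refl refl le | yes pj = pi , pj , (q , refl , refl)

    delivered-cut : ∀ {i s j s'} → Delivered cutRun (i , s) (j , s') → s' ≤ H →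
      Past i s × Past j s' × Delivered r (i , s) (j , s')
    delivered-cut {i} {s} (q , to-j , at) = deliver-cut i s (past? i s) (fix i s) q to-j at

    occurs-cut : ∀ e → Occurs cutRun e → evTime e ≤ H → Past (evProc e) (evTime e)
    occurs-cut (ext i u v) o le with past? i u
    ... | yes p = p
    occurs-cut (ext i u v) () le | no _
    occurs-cut (rcv j u i μ) (s , q , to-j , at , _) le = proj₁ (proj₂ (delivered-cut (q , to-j , at) le))

    outside-stays : ∀ {x y} → HB cutRun x y → ¬ Past (proj₁ x) (proj₂ x) → proj₂ y ≤ H → proj₁ y ≡ proj₁ x
    outside-stays (hb-local _) out le = refl
    outside-stays (hb-msg d) out le = ⊥-elim (out (proj₁ (delivered-cut d le)))
    outside-stays {i , s} (hb-trans {b = m , sm} a b) out le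
      with outside-stays a out (≤-trans (HB-mono b) le)
    ... | refl = outside-stays b (λ pm → out (Past-earlier (HB-mono a) pm)) le

    last-in-past : ∀ {x y} → HB cutRun x y → Past (proj₁ x) (proj₂ x) → proj₂ y ≤ H →
      ∃ λ s'' → Past (proj₁ y) s'' × s'' ≤ proj₂ y × HB r x (proj₁ y , s'')
    last-in-past {i , s} (hb-local le) px _ = s , px , le , hb-local ≤-refl
    last-in-past (hb-msg {b = _ , s'} d) _ le with delivered-cut d le
    ... | _ , pj , d' = s' , pj , ≤-refl , hb-msg d'
    last-in-past (hb-trans {b = m , sm} a b) px le
      with last-in-past a px (≤-trans (HB-mono b) le) | past? m sm
    ... | s₁ , p₁ , s₁≤ , h₁ | yes pm with last-in-past b pm le
    ...   | s₂ , p₂ , s₂≤ , h₂ = s₂ , p₂ , s₂≤ , hb-trans (hb-trans h₁ (hb-local s₁≤)) h₂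
    last-in-past {y = j , s'} (hb-trans {b = m , sm} a b) px le
        | s₁ , p₁ , s₁≤ , h₁ | no ¬pm with outside-stays b ¬pm le
    ...   | refl = s₁ , p₁ , ≤-trans s₁≤ (HB-mono b) , h₁

    transfer : ∀ {lo j s s₀ js} → Chain cutRun lo H j s js → Past j s₀ → lo ≤ s₀ → s₀ ≤ s →
      Chain r lo H j s₀ (js ∷ʳ k)
    transfer (done _ _) p₀ lo≤ _ =
      step lo≤ (Past-≤H p₀) (Past⇒HB p₀) (done (≤-trans lo≤ (Past-≤H p₀)) ≤-refl)
    transfer (step _ _ hb ch) p₀ lo≤ s₀≤
      with last-in-past (hb-trans (hb-local s₀≤) hb) p₀ (chain-≤hi ch)
    ... | s'' , p'' , s''≤ , h =
      step lo≤ (Past-≤H p₀) h (transfer ch p'' (≤-trans lo≤ (HB-mono h)) s''≤)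

  knowledge-chain : ∀ e t' {is} → Reverse is → ∀ r →
    Knest is (ndocc e) r t' → Chain r (evTime e) t' (evProc e) (evTime e) is
  knowledge-chain e t' [] r (_ , le) = done ≤-refl le
  knowledge-chain e t' (js ∶ knowers ∶ʳ k) r kn =
    transfer (knowledge-chain e t' knowers cutRun known) (occurs-cut e occ le) ≤-refl ≤-refl
    where
    open Cut r k t'
    known : Knest js (ndocc e) cutRun t'
    known = Knest-∷ʳ js k (ndocc e) r t' kn cutRun local-cut
    occ : Occurs cutRun e
    occ = proj₁ (Knest-veridical js (ndocc e) cutRun t' known)
    le : evTime e ≤ t'
    le = proj₂ (Knest-veridical js (ndocc e) cutRun t' known)

mainTheorem13 : (C : Context) (P : Protocol C) →
    let open Runs C P in
    (r : Run) (e : NDEvent) (i₀ : Fin n) (t t' : ℕ) (is : List (Fin n)) →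
    Occurs r e → evProc e ≡ i₀ → evTime e ≡ t →
    Knest is (ndocc e) r t' →
    Chain r t t' i₀ t is
mainTheorem13 C P r e _ _ t' is _ refl refl kn =
  Semantics.knowledge-chain C P e t' (reverseView is) r kn
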